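{- Let $\Gamma$ be a distance-regular graph with diameter $D\ge 3$ and valency $k$, and assume $\Gamma$ is bipartite or almost bipartite. Then: (i) for every $\theta\in\mathbb{R}$ the pair $\theta,k$ is tight; (ii) for every $\theta\in\mathbb{R}$ the pair $\theta,-k$ is tight; (iii) $\Gamma$ has no further tight pairs: if $\theta,\theta'\in\mathbb{R}$ form a tight pair, then at least one of $\theta,\theta'$ lies in $\{k,-k\}$.
   Context: $\Gamma$ is a finite, undirected, connected graph without loops or multiple edges, with path-length distance $\partial$ and diameter $D$. It is distance-regular: for all $0\le h,i,j\le D$ and all vertices $x,y$ with $\partial(x,y)=h$, the number $p^h_{ij}$ of vertices $z$ with $\partial(x,z)=i$ and $\partial(y,z)=j$ depends only on $h,i,j$. Write $a_i=p^i_{1i}$ $(0\le i\le D)$, $b_i=p^i_{1,i+1}$ $(0\le i\le D-1)$, $c_i=p^i_{1,i-1}$ $(1\le i\le D)$, $c_0=0$, $b_D=0$, and $k=b_0$ (the valency). $\Gamma$ is bipartite if $a_i=0$ for $0\le i\le D$, and almost bipartite if $a_D\ne0$ and $a_i=0$ for $0\le i\le D-1$. For $\theta\in\mathbb{R}$, the pseudo cosine sequence for $\theta$ is the unique sequence of reals $\sigma_0,\dots,\sigma_D$ with $\sigma_0=1$ and $c_i\sigma_{i-1}+a_i\sigma_i+b_i\sigma_{i+1}=\theta\sigma_i$ for $0\le i\le D-1$ (the term $c_0\sigma_{ -1}$ is $0$). Two pseudo cosine sequences $\sigma_0,\dots,\sigma_D$ and $\rho_0,\dots,\rho_D$ form a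 tight pair if $\sigma_0\rho_0,\dots,\sigma_D\rho_D$ is also a pseudo cosine sequence (for some real number). Real numbers $\theta,\theta'$ form a tight pair if their pseudo cosine sequences form a tight pair. -}

module Defs where

open import Data.Nat using (ℕ; zero; suc; _∸_; _≤_; _<_)
open import Data.Bool using (Bool; true; false; _∧_; _∨_; not; if_then_else_)
open import Data.Fin using (Fin)
open import Data.List using (List; map; foldr)
open import Data.List.Base using (allFin)
open import Data.Product using (Σ; ∃; _×_; _,_)
open import Data.Sum using (_⊎_)
open import Relation.Binary.PropositionalEquality using (_≡_; _≢_)
open import Relation.Nullary using (¬_)

-- The real numbers, given axiomatically as a (Dedekind-)complete
-- ordered field.  All models are isomorphic, so quantifying over every
-- model is the same as speaking about ℝ.

record RealNumbers : Set₁ where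
  infixl 6 _+_
  infixl 7 _*_
  infix 4 _<ℝ_ _≤ℝ_
  field
    ℝ    : Set
    0ℝ 1ℝ : ℝ
    _+_ _*_ : ℝ → ℝ → ℝ
    -_   : ℝ → ℝ
    _<ℝ_ : ℝ → ℝ → Set
    +-assoc    : ∀ x y z → (x + y) + z ≡ x + (y + z)
    +-comm     : ∀ x y → x + y ≡ y + x
    +-identity : ∀ x → 0ℝ + x ≡ x
    +-inverse  : ∀ x → x + (- x) ≡ 0ℝ
    *-assoc    : ∀ x y z → (x * y) * z ≡ x * (y * z)
    *-comm     : ∀ x y → x * y ≡ y * x
    *-identity : ∀ x → 1ℝ * x ≡ x
    distrib    : ∀ x y z → x * (y + z) ≡ x * y + x * z
    0≢1        : 0ℝ ≢ 1ℝ
    *-inverse  : ∀ x → x ≢ 0ℝ → ∃ λ y → x * y ≡ 1ℝ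
    <-irrefl   : ∀ x → ¬ (x <ℝ x)
    <-trans    : ∀ x y z → x <ℝ y → y <ℝ z → x <ℝ z
    <-trichotomy : ∀ x y → x <ℝ y ⊎ (x ≡ y ⊎ y <ℝ x)
    +-mono-<   : ∀ x y z → x <ℝ y → x + z <ℝ y + z
    *-pos      : ∀ x y → 0ℝ <ℝ x → 0ℝ <ℝ y → 0ℝ <ℝ x * y

  _≤ℝ_ : ℝ → ℝ → Set
  x ≤ℝ y = x <ℝ y ⊎ x ≡ y

  field
    complete : ∀ (P : ℝ → Set) → (∃ λ x → P x) → (∃ λ b → ∀ x → P x → x ≤ℝ b) →
               ∃ λ s → (∀ x → P x → x ≤ℝ s) × (∀ b → (∀ x → P x → x ≤ℝ b) → s ≤ℝ b)

  fromℕ : ℕ → ℝ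
  fromℕ zero    = 0ℝ
  fromℕ (suc n) = 1ℝ + fromℕ n

record Graph : Set where
  field
    n     : ℕ
    adj   : Fin n → Fin n → Bool
    adj-sym   : ∀ x y → adj x y ≡ adj y x
    adj-irrefl : ∀ x → adj x x ≡ false

  anyV : (Fin n → Bool) → Bool
  anyV f = foldr _∨_ false (map f (allFin n))

open Graph public

open import Data.Fin using (_≟_)
open import Relation.Nullary.Decidable using (⌊_⌋)

-- within G l x y = true  iff  ∂(x,y) ≤ l
within : (G : Graph) → ℕ → Fin (n G) → Fin (n G) → Bool
within G zero    x y = ⌊ x ≟ y ⌋
within G (suc l) x y = within G l x y ∨ anyV G (λ z → within G l x z ∧ adj G z y)

isDist : (G : Graph) → ℕ → Fin (n G) → Fin (n G) → Bool
isDist G zero    x y = within G zero x y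
isDist G (suc i) x y = within G (suc i) x y ∧ not (within G i x y)

countP : (G : Graph) → ℕ → ℕ → Fin (n G) → Fin (n G) → ℕ
countP G i j x y =
  foldr Data.Nat._+_ 0 (map (λ z → if isDist G i x z ∧ isDist G j y z then 1 else 0) (allFin (n G)))

Connected : Graph → Set
Connected G = ∀ x y → ∃ λ l → within G l x y ≡ true

HasDiameter : Graph → ℕ → Set
HasDiameter G D = (∀ x y → within G D x y ≡ true) × (∃ λ x → ∃ λ y → isDist G D x y ≡ true)

record DRG : Set where
  field
    graph     : Graph
    connected : Connected graph
    D         : ℕ
    diameter  : HasDiameter graph D
    p         : ℕ → ℕ → ℕ → ℕ
    regular   : ∀ h i j → h ≤ D → i ≤ D → j ≤ D →
                ∀ x y → isDist graph h x y ≡ true → countP graph i j x y ≡ p h i j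

  a b c : ℕ → ℕ
  a i = p i 1 i
  b i = p i 1 (suc i)
  c zero    = 0
  c (suc i) = p (suc i) 1 i

  k : ℕ
  k = b 0

  Bipartite : Set
  Bipartite = ∀ i → i ≤ D → a i ≡ 0

  AlmostBipartite : Set
  AlmostBipartite = a D ≢ 0 × (∀ i → i < D → a i ≡ 0)

module _ (RR : RealNumbers) (Γ : DRG) where
  open RealNumbers RR
  open DRG Γ

  -- σ : ℕ → ℝ; only σ 0, …, σ D are relevant.
  IsPseudoCosine : ℝ → (ℕ → ℝ) → Set
  IsPseudoCosine θ σ =
    σ 0 ≡ 1ℝ ×
    (∀ i → i < D →
      (fromℕ (c i) * σ (i ∸ 1) + fromℕ (a i) * σ i) + fromℕ (b i) * σ (suc i) ≡ θ * σ i)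

  TightPair : ℝ → ℝ → Set
  TightPair θ θ' = ∀ σ ρ → IsPseudoCosine θ σ → IsPseudoCosine θ' ρ →
                   ∃ λ η → IsPseudoCosine η (λ i → σ i * ρ i)

-- When a_i = 0 for i < D, the recurrence of a pseudo cosine sequence reads
-- c_i σ_{i-1} + b_i σ_{i+1} = θ σ_i with c_i + b_i = k. So for ε = ±1 the sequence ε^i is the
-- pseudo cosine sequence of εk, and multiplying a pseudo cosine sequence for θ termwise by ε^i
-- gives one for εθ; as b_i ≠ 0 makes pseudo cosine sequences unique, θ and ±k are tight.
-- Conversely, the equations at i = 0, 1 give θ = kσ₁ and c₁ + b₁σ₂ = kσ₁². Writing them for θ,
-- for θ′ and for the product sequence and eliminating σ₂, ρ₂ leaves c₁k(σ₁² − 1)(ρ₁² − 1) = 0,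
-- so σ₁ = ±1 or ρ₁ = ±1.
module Submission where

open import Defs
open import Algebra.Bundles using (CommutativeRing; Semiring)
import Algebra.Definitions.RawSemiring as RawSemiringDefinitions
import Algebra.Properties.AbelianGroup as AbelianGroupProperties
import Algebra.Properties.CommutativeSemigroup as CommutativeSemigroupProperties
import Algebra.Properties.Group as GroupProperties
import Algebra.Properties.Monoid.Mult as MonoidMult
import Algebra.Properties.Ring as RingProperties
import Algebra.Properties.Semiring.Mult as SemiringMult
open import Algebra.Solver.Ring.AlmostCommutativeRing using (fromCommutativeRing; _-Raw-AlmostCommutative⟶_)
open import Data.Bool.Base using (Bool; true; false; T; _∧_; not; if_then_else_)
open import Data.Bool.Properties using (T-∨; T-∧; T-≡; T?; ∧-idem)
open import Data.Empty using (⊥-elim)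
open import Data.Fin.Base using (Fin)
open import Data.Fin.Properties using (_≟_)
open import Data.Integer.Base as ℤ using (ℤ; -[1+_])
import Data.Integer.Properties as ℤ
open import Data.List.Base using (List; []; _∷_; allFin; map)
open import Data.List.Membership.Propositional using (_∈_; lose)
open import Data.List.Membership.Propositional.Properties using (∈-allFin)
open import Data.List.Properties using (map-cong)
open import Data.List.Relation.Unary.Any using (satisfied; here; there)
open import Data.List.Relation.Unary.Any.Properties using (any⁺; any⁻)
import Data.Maybe.Base as Maybe
open import Data.Nat.Base as ℕ using (ℕ; zero; suc; _∸_; _≤_; _<_; _≤′_; ≤′-refl; ≤′-step; s≤s; z≤n)
import Data.Nat.Properties as ℕ
open import Data.Nat.Properties
  using (≤⇒≤′; <-cmp; <⇒≤; n≤1+n; m<1+n⇒m<n∨m≡n; <⇒≢; >⇒≢; n<1+n; m<n⇒m<1+n; m∸n≤m;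
         ≤-trans; ≤-reflexive; m≤m+n; m≤n+m)
open import Data.Nat.ListAction using (sum)
open import Data.Product using (∃-syntax; _×_; _,_; proj₁; proj₂)
open import Data.Sign.Base as Sign using (Sign)
open import Data.Sum as Sum using (_⊎_; inj₁; inj₂; [_,_]′)
open import Data.Unit using (tt)
open import Function.Bundles using (Equivalence)
open import Relation.Binary.Definitions using (tri<; tri≈; tri>)
open import Relation.Binary.PropositionalEquality
open import Relation.Nullary using (¬_; Dec; yes; no)
open import Relation.Nullary.Decidable using (toWitness; fromWitness; dec⇒maybe)

T-not⁺ : ∀ {b} → ¬ T b → T (not b)
T-not⁺ {false} _  = tt
T-not⁺ {true}  ¬b = ¬b tt

T-not⁻ : ∀ {b} → T (not b) → ¬ T b
T-not⁻ {false} _ ()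

module Counting where
  open import Data.Nat.Base using (_+_)
  open CommutativeSemigroupProperties ℕ.+-commutativeSemigroup using () renaming (interchange to +-interchange)

  indicator : Bool → ℕ
  indicator b = if b then 1 else 0

  indicator-true : ∀ {b} → T b → indicator b ≡ 1
  indicator-true {true} _ = refl

  indicator-false : ∀ {b} → ¬ T b → indicator b ≡ 0
  indicator-false {false} _  = refl
  indicator-false {true}  ¬b = ⊥-elim (¬b tt)

  count : ∀ {A : Set} → List A → (A → Bool) → ℕ
  count xs P = sum (map (λ z → indicator (P z)) xs)

  count-≥1 : ∀ {A : Set} {xs : List A} {P x} → x ∈ xs → T (P x) → 1 ≤ count xs P
  count-≥1 {xs = x ∷ xs} (here refl) Px = ≤-trans (≤-reflexive (sym (indicator-true Px))) (m≤m+n _ _)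
  count-≥1 {xs = y ∷ xs} {P} (there x∈xs) Px = ≤-trans (count-≥1 x∈xs Px) (m≤n+m _ (indicator (P y)))

  count-cong : ∀ {A : Set} {P Q : A → Bool} → (∀ z → P z ≡ Q z) → ∀ xs → count xs P ≡ count xs Q
  count-cong P≗Q xs = cong sum (map-cong (λ z → cong indicator (P≗Q z)) xs)

  sum-map-+ : ∀ {A : Set} (f g : A → ℕ) xs → sum (map (λ z → f z + g z) xs) ≡ sum (map f xs) + sum (map g xs)
  sum-map-+ f g []       = refl
  sum-map-+ f g (x ∷ xs) = trans (cong (f x + g x +_) (sum-map-+ f g xs)) (+-interchange (f x) (g x) _ _)

  count-∧-partition : ∀ {A : Set} {P Q₁ Q₂ Q₃ : A → Bool} →
    (∀ z → T (P z) → indicator (Q₁ z) + indicator (Q₂ z) + indicator (Q₃ z) ≡ 1) → ∀ xs →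
    count xs (λ z → P z ∧ Q₁ z) + count xs (λ z → P z ∧ Q₂ z) + count xs (λ z → P z ∧ Q₃ z) ≡ count xs P
  count-∧-partition {A} {P} {Q₁} {Q₂} {Q₃} partition xs = begin
    count xs (λ z → P z ∧ Q₁ z) + count xs (λ z → P z ∧ Q₂ z) + count xs (λ z → P z ∧ Q₃ z)
      ≡⟨ cong (_+ count xs (λ z → P z ∧ Q₃ z)) (sum-map-+ (ι∧ Q₁) (ι∧ Q₂) xs) ⟨
    sum (map (λ z → ι∧ Q₁ z + ι∧ Q₂ z) xs) + count xs (λ z → P z ∧ Q₃ z)
      ≡⟨ sum-map-+ (λ z → ι∧ Q₁ z + ι∧ Q₂ z) (ι∧ Q₃) xs ⟨
    sum (map (λ z → ι∧ Q₁ z + ι∧ Q₂ z + ι∧ Q₃ z) xs)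
      ≡⟨ cong sum (map-cong pointwise xs) ⟩
    count xs P ∎
    where
    open ≡-Reasoning
    ι∧ : (A → Bool) → A → ℕ
    ι∧ Q z = indicator (P z ∧ Q z)
    pointwise : ∀ z → ι∧ Q₁ z + ι∧ Q₂ z + ι∧ Q₃ z ≡ indicator (P z)
    pointwise z with P z | partition z
    ... | false | _   = refl
    ... | true  | exactlyOne = exactlyOne tt

open Counting

module Distance (G : Graph) where
  open import Data.Nat.Base using (_+_)


  V : Set
  V = Fin (n G)

  Adjacent : V → V → Set
  Adjacent x y = T (adj G x y)

  -- Records rather than T (within G l x y), so that the indices are inferred from a proof.
  record Within (l : ℕ) (x y : V) : Set where
    constructor ⟨_⟩
    field holds : T (within G l x y)

  record AtDistance (i : ℕ) (x y : V) : Set where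
    constructor ⟨_⟩
    field holds : T (isDist G i x y)

  open Within public
  open AtDistance public

  adjacent-sym : ∀ {x y} → Adjacent x y → Adjacent y x
  adjacent-sym {x} {y} a = subst T (adj-sym G x y) a

  adjacent-irrefl : ∀ {x} → ¬ Adjacent x x
  adjacent-irrefl {x} a = subst T (adj-irrefl G x) a

  within-zero⁺ : ∀ {x} → Within 0 x x
  within-zero⁺ {x} = ⟨ fromWitness {a? = x ≟ x} refl ⟩

  within-zero⁻ : ∀ {x y} → Within 0 x y → x ≡ y
  within-zero⁻ {x} {y} ⟨ w ⟩ = toWitness {a? = x ≟ y} w

  within-weaken : ∀ {l x y} → Within l x y → Within (suc l) x y
  within-weaken ⟨ w ⟩ = ⟨ Equivalence.from T-∨ (inj₁ w) ⟩

  within-step : ∀ {l x z y} → Within l x z → Adjacent z y → Within (suc l) x y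
  within-step {z = z} ⟨ w ⟩ a =
    ⟨ Equivalence.from T-∨ (inj₂ (any⁺ _ (lose (∈-allFin z) (Equivalence.from T-∧ (w , a))))) ⟩

  within-suc⁻ : ∀ {l x y} → Within (suc l) x y → Within l x y ⊎ ∃[ z ] Within l x z × Adjacent z y
  within-suc⁻ ⟨ w ⟩ with Equivalence.to T-∨ w
  ... | inj₁ w′ = inj₁ ⟨ w′ ⟩
  ... | inj₂ w′ with satisfied (any⁻ _ (allFin (n G)) w′)
  ...   | z , wz = let (w″ , a) = Equivalence.to T-∧ wz in inj₂ (z , ⟨ w″ ⟩ , a)

  within-cons : ∀ {l x w y} → Adjacent x w → Within l w y → Within (suc l) x y
  within-cons {zero} a w with within-zero⁻ w
  ... | refl = within-step within-zero⁺ a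
  within-cons {suc l} a w with within-suc⁻ w
  ... | inj₁ w′          = within-weaken (within-cons a w′)
  ... | inj₂ (z , w′ , b) = within-step (within-cons a w′) b

  within-sym : ∀ {l x y} → Within l x y → Within l y x
  within-sym {zero} w with within-zero⁻ w
  ... | refl = w
  within-sym {suc l} w with within-suc⁻ w
  ... | inj₁ w′          = within-weaken (within-sym w′)
  ... | inj₂ (z , w′ , a) = within-cons (adjacent-sym a) (within-sym w′)

  within-mono : ∀ {l m x y} → l ≤ m → Within l x y → Within m x y
  within-mono {l} {x = x} {y} l≤m w = weaken* (≤⇒≤′ l≤m)
    where
    weaken* : ∀ {m} → l ≤′ m → Within m x y
    weaken* ≤′-refl         = w
    weaken* (≤′-step l≤′m)  = within-weaken (weaken* l≤′m)

  atDistance-zero⁻ : ∀ {x y} → AtDistance 0 x y → x ≡ y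
  atDistance-zero⁻ ⟨ d ⟩ = within-zero⁻ ⟨ d ⟩

  atDistance-zero⁺ : ∀ {x} → AtDistance 0 x x
  atDistance-zero⁺ = ⟨ holds within-zero⁺ ⟩

  atDistance⇒within : ∀ {i x y} → AtDistance i x y → Within i x y
  atDistance⇒within {zero}  ⟨ d ⟩ = ⟨ d ⟩
  atDistance⇒within {suc i} ⟨ d ⟩ = ⟨ proj₁ (Equivalence.to T-∧ d) ⟩

  atDistance-suc⁻ : ∀ {i x y} → AtDistance (suc i) x y → ¬ Within i x y
  atDistance-suc⁻ ⟨ d ⟩ ⟨ w ⟩ = T-not⁻ (proj₂ (Equivalence.to T-∧ d)) w

  atDistance-suc⁺ : ∀ {i x y} → Within (suc i) x y → ¬ Within i x y → AtDistance (suc i) x y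
  atDistance-suc⁺ ⟨ w ⟩ ¬w = ⟨ Equivalence.from T-∧ (w , T-not⁺ (λ w′ → ¬w ⟨ w′ ⟩)) ⟩

  atDistance-sym : ∀ {i x y} → AtDistance i x y → AtDistance i y x
  atDistance-sym {zero} d with atDistance-zero⁻ d
  ... | refl = d
  atDistance-sym {suc i} d =
    atDistance-suc⁺ (within-sym (atDistance⇒within d)) (λ w → atDistance-suc⁻ d (within-sym w))

  atDistance-< : ∀ {i j x y} → AtDistance i x y → AtDistance j x y → ¬ i < j
  atDistance-< {j = suc j} dᵢ dⱼ (s≤s i≤j) = atDistance-suc⁻ dⱼ (within-mono i≤j (atDistance⇒within dᵢ))

  atDistance-unique : ∀ {i j x y} → AtDistance i x y → AtDistance j x y → i ≡ j
  atDistance-unique {i} {j} dᵢ dⱼ with <-cmp i j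
  ... | tri< i<j _ _ = ⊥-elim (atDistance-< dᵢ dⱼ i<j)
  ... | tri≈ _ i≡j _ = i≡j
  ... | tri> _ _ j<i = ⊥-elim (atDistance-< dⱼ dᵢ j<i)

  within-beside-outside⇒atDistance : ∀ {l x z y} → Within l x z → Adjacent z y → ¬ Within l x y →
                                     AtDistance l x z
  within-beside-outside⇒atDistance {zero}  w _ _  = ⟨ holds w ⟩
  within-beside-outside⇒atDistance {suc l} w a ¬w =
    atDistance-suc⁺ w (λ w′ → ¬w (within-step w′ a))

  atDistance-pred : ∀ {l x y} → AtDistance (suc l) x y → ∃[ z ] AtDistance l x z × Adjacent z y
  atDistance-pred d with within-suc⁻ (atDistance⇒within d)
  ... | inj₁ w           = ⊥-elim (atDistance-suc⁻ d w)
  ... | inj₂ (z , w , a) = z , within-beside-outside⇒atDistance w a (atDistance-suc⁻ d) , a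

  adjacent⇒atDistance-one : ∀ {x y} → Adjacent x y → AtDistance 1 x y
  adjacent⇒atDistance-one {x} a = atDistance-suc⁺ (within-step within-zero⁺ a)
    (λ w → adjacent-irrefl (subst (Adjacent x) (sym (within-zero⁻ w)) a))

  atDistance-one⇒adjacent : ∀ {x y} → AtDistance 1 x y → Adjacent x y
  atDistance-one⇒adjacent d with atDistance-pred d
  ... | z , d₀ , a with atDistance-zero⁻ d₀
  ...   | refl = a

  neighbour-atDistance : ∀ {i y x z} → AtDistance (suc i) y x → Adjacent x z →
    AtDistance i y z ⊎ AtDistance (suc i) y z ⊎ AtDistance (suc (suc i)) y z
  neighbour-atDistance {i} {y} {x} {z} d a with T? (within G (suc i) y z)
  ... | no ¬w₁ = inj₂ (inj₂ (atDistance-suc⁺ (within-step (atDistance⇒within d) a) (λ w → ¬w₁ (holds w))))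
  ... | yes w₁ with T? (within G i y z)
  ...   | no ¬w₀ = inj₂ (inj₁ (atDistance-suc⁺ ⟨ w₁ ⟩ (λ w → ¬w₀ (holds w))))
  ...   | yes w₀ = inj₁ (within-beside-outside⇒atDistance ⟨ w₀ ⟩ (adjacent-sym a) (atDistance-suc⁻ d))

  indicator-isDist-≢ : ∀ {i j y z} → AtDistance i y z → i ≢ j → indicator (isDist G j y z) ≡ 0
  indicator-isDist-≢ d i≢j = indicator-false (λ t → i≢j (atDistance-unique d ⟨ t ⟩))

  atDistance-one-of-three : ∀ {i y z} →
    AtDistance i y z ⊎ AtDistance (suc i) y z ⊎ AtDistance (suc (suc i)) y z →
    indicator (isDist G i y z) + indicator (isDist G (suc i) y z) + indicator (isDist G (suc (suc i)) y z) ≡ 1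
  atDistance-one-of-three {i} (inj₁ d) = cong₂ _+_ (cong₂ _+_ (indicator-true (holds d))
    (indicator-isDist-≢ d (<⇒≢ (n<1+n i)))) (indicator-isDist-≢ d (<⇒≢ (m<n⇒m<1+n (n<1+n i))))
  atDistance-one-of-three {i} (inj₂ (inj₁ d)) = cong₂ _+_ (cong₂ _+_ (indicator-isDist-≢ d (>⇒≢ (n<1+n i)))
    (indicator-true (holds d))) (indicator-isDist-≢ d (<⇒≢ (n<1+n (suc i))))
  atDistance-one-of-three {i} (inj₂ (inj₂ d)) = cong₂ _+_ (cong₂ _+_ (indicator-isDist-≢ d (>⇒≢ (m<n⇒m<1+n (n<1+n i))))
    (indicator-isDist-≢ d (>⇒≢ (n<1+n (suc i))))) (indicator-true (holds d))

module DistanceRegular (Γ : DRG) where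
  open import Data.Nat.Base using (_+_)
  open DRG Γ
  open Distance graph

  vertices : List V
  vertices = allFin (n graph)

  intersection-number : ∀ {h i j x y} → h ≤ D → i ≤ D → j ≤ D → AtDistance h x y →
    count vertices (λ z → isDist graph i x z ∧ isDist graph j y z) ≡ p h i j
  intersection-number h≤D i≤D j≤D d = regular _ _ _ h≤D i≤D j≤D _ _ (Equivalence.to T-≡ (holds d))

  geodesic-edge : ∀ {m u v} → AtDistance m u v → ∀ {i} → i < m →
    ∃[ w ] ∃[ w′ ] AtDistance i u w × Adjacent w w′ × AtDistance (suc i) u w′
  geodesic-edge {suc m} d i<1+m with atDistance-pred d
  ... | z , d′ , a with m<1+n⇒m<n∨m≡n i<1+m
  ...   | inj₁ i<m  = geodesic-edge d′ i<m
  ...   | inj₂ refl = z , _ , d′ , a , d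

  edge-between-layers : ∀ {i} → i < D → ∃[ u ] ∃[ w ] ∃[ w′ ] AtDistance i u w × Adjacent w w′ × AtDistance (suc i) u w′
  edge-between-layers i<D with proj₂ diameter
  ... | u , v , d = u , geodesic-edge ⟨ Equivalence.from T-≡ d ⟩ i<D

  c+a+b≡k : ∀ {i} → suc i < D → c (suc i) + a (suc i) + b (suc i) ≡ k
  c+a+b≡k {i} i+1<D with edge-between-layers i+1<D
  ... | u , w , _ , d , _ , _ = begin
    c (suc i) + a (suc i) + b (suc i)
      ≡⟨ cong₂ _+_ (cong₂ _+_ (count-w-neighbour-at (≤-trans (n≤1+n i) i+1≤D)) (count-w-neighbour-at i+1≤D))
                   (count-w-neighbour-at i+1<D) ⟨
    count vertices (w-neighbour-at i) + count vertices (w-neighbour-at (suc i))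
      + count vertices (w-neighbour-at (suc (suc i)))
      ≡⟨ count-∧-partition (λ z t → atDistance-one-of-three (neighbour-atDistance d (atDistance-one⇒adjacent ⟨ t ⟩))) vertices ⟩
    count vertices (isDist graph 1 w)
      ≡⟨ count-cong (λ z → ∧-idem (isDist graph 1 w z)) vertices ⟨
    count vertices (λ z → isDist graph 1 w z ∧ isDist graph 1 w z)
      ≡⟨ intersection-number z≤n 1≤D 1≤D (atDistance-zero⁺ {w}) ⟩
    k ∎
    where
    open ≡-Reasoning
    i+1≤D : suc i ≤ D
    i+1≤D = <⇒≤ i+1<D
    1≤D : 1 ≤ D
    1≤D = ≤-trans (s≤s z≤n) i+1≤D
    w-neighbour-at : ℕ → V → Bool
    w-neighbour-at j z = isDist graph 1 w z ∧ isDist graph j u z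
    count-w-neighbour-at : ∀ {j} → j ≤ D → count vertices (w-neighbour-at j) ≡ p (suc i) 1 j
    count-w-neighbour-at j≤D = intersection-number i+1≤D 1≤D j≤D (atDistance-sym d)

  b-positive : ∀ {i} → i < D → 1 ≤ b i
  b-positive i<D with edge-between-layers i<D
  ... | u , w , w′ , d , a , d′ =
    subst (1 ≤_) (intersection-number (<⇒≤ i<D) (≤-trans (s≤s z≤n) i<D) i<D (atDistance-sym d))
      (count-≥1 (∈-allFin w′) (Equivalence.from T-∧ (holds (adjacent⇒atDistance-one a) , holds d′)))

  c₁-positive : 0 < D → 1 ≤ c 1
  c₁-positive 0<D with edge-between-layers 0<D
  ... | _ , w , w′ , _ , a , _ =
    subst (1 ≤_) (intersection-number 0<D 0<D z≤n (adjacent⇒atDistance-one (adjacent-sym a)))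
      (count-≥1 (∈-allFin w) (Equivalence.from T-∧ (holds (adjacent⇒atDistance-one (adjacent-sym a)) , holds atDistance-zero⁺)))

module RealArithmetic (RR : RealNumbers) where
  open RealNumbers RR

  commutativeRing : CommutativeRing _ _
  commutativeRing = record
    { Carrier = ℝ ; _≈_ = _≡_ ; _+_ = _+_ ; _*_ = _*_ ; -_ = -_ ; 0# = 0ℝ ; 1# = 1ℝ
    ; isCommutativeRing = record
      { isRing = record
        { +-isAbelianGroup = record
          { isGroup = record
            { isMonoid = record
              { isSemigroup = record
                { isMagma = record { isEquivalence = isEquivalence ; ∙-cong = cong₂ _+_ }
                ; assoc = +-assoc }
              ; identity = +-identity , λ x → trans (+-comm x 0ℝ) (+-identity x) }
            ; inverse = (λ x → trans (+-comm (- x) x) (+-inverse x)) , +-inverse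
            ; ⁻¹-cong = cong -_ }
          ; comm = +-comm }
        ; *-cong = cong₂ _*_
        ; *-assoc = *-assoc
        ; *-identity = *-identity , λ x → trans (*-comm x 1ℝ) (*-identity x)
        ; distrib = distrib , λ x y z → trans (*-comm (y + z) x)
                      (trans (distrib x y z) (cong₂ _+_ (*-comm x y) (*-comm x z))) }
      ; *-comm = *-comm } }

  open CommutativeRing commutativeRing public
    using (_-_; distribʳ; *-identityʳ; +-identityʳ; zeroʳ; zeroˡ; ring; semiring; +-group)
  open GroupProperties +-group public
    using (∙-cancelˡ; ∙-cancelʳ; ε⁻¹≈ε; ⁻¹-involutive; x∙y⁻¹≈ε⇒x≈y; x≈y⇒x∙y⁻¹≈ε; x≈z//y; ⁻¹-anti-homo-//)
  open RingProperties ring public using (-1*x≈-x; -‿distribʳ-*)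
  open AbelianGroupProperties (CommutativeRing.+-abelianGroup commutativeRing) using (⁻¹-∙-comm)
  open CommutativeSemigroupProperties (CommutativeRing.*-commutativeSemigroup commutativeRing)
    using (interchange)
  open MonoidMult (CommutativeRing.+-monoid commutativeRing) using (×-homo-+) renaming (_×_ to _×ℝ_)
  open SemiringMult semiring using (×1-homo-*)

  -1*-1≡1 : - 1ℝ * - 1ℝ ≡ 1ℝ
  -1*-1≡1 = trans (-1*x≈-x (- 1ℝ)) (⁻¹-involutive 1ℝ)

  fromℕ≡×1 : ∀ n → fromℕ n ≡ n ×ℝ 1ℝ
  fromℕ≡×1 zero    = refl
  fromℕ≡×1 (suc n) = cong (1ℝ +_) (fromℕ≡×1 n)

  fromℕ-+ : ∀ m n → fromℕ (m ℕ.+ n) ≡ fromℕ m + fromℕ n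
  fromℕ-+ m n rewrite fromℕ≡×1 (m ℕ.+ n) | fromℕ≡×1 m | fromℕ≡×1 n = ×-homo-+ 1ℝ m n

  fromℕ-* : ∀ m n → fromℕ (m ℕ.* n) ≡ fromℕ m * fromℕ n
  fromℕ-* m n rewrite fromℕ≡×1 (m ℕ.* n) | fromℕ≡×1 m | fromℕ≡×1 n = ×1-homo-* m n

  fromℕ-∸ : ∀ {m n} → n ℕ.≤ m → fromℕ (m ℕ.∸ n) ≡ fromℕ m - fromℕ n
  fromℕ-∸ {m} {n} n≤m = x≈z//y _ _ _
    (trans (sym (fromℕ-+ (m ℕ.∸ n) n)) (cong fromℕ (ℕ.m∸n+n≡m n≤m)))

  -- ℤ is the coefficient ring of the ring solver for ℝ: coefficients taken in ℝ itself
  -- would not compute, so normal forms could not be compared by refl.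
  ⟦_⟧ℤ : ℤ → ℝ
  ⟦ ℤ.+ n ⟧ℤ    = fromℕ n
  ⟦ -[1+ n ] ⟧ℤ = - fromℕ (suc n)

  ⟦-⟧ℤ : ∀ i → ⟦ ℤ.- i ⟧ℤ ≡ - ⟦ i ⟧ℤ
  ⟦-⟧ℤ (ℤ.+ zero)  = sym ε⁻¹≈ε
  ⟦-⟧ℤ (ℤ.+ suc n) = refl
  ⟦-⟧ℤ -[1+ n ]    = sym (⁻¹-involutive _)

  ⟦⊖⟧ℤ : ∀ m n → ⟦ m ℤ.⊖ n ⟧ℤ ≡ fromℕ m - fromℕ n
  ⟦⊖⟧ℤ m n with ℕ.≤-total n m
  ... | inj₁ n≤m = trans (cong ⟦_⟧ℤ (ℤ.⊖-≥ n≤m)) (fromℕ-∸ n≤m)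
  ... | inj₂ m≤n = begin
    ⟦ m ℤ.⊖ n ⟧ℤ                ≡⟨ cong ⟦_⟧ℤ (ℤ.⊖-≤ m≤n) ⟩
    ⟦ ℤ.- (ℤ.+ (n ℕ.∸ m)) ⟧ℤ    ≡⟨ ⟦-⟧ℤ (ℤ.+ (n ℕ.∸ m)) ⟩
    - fromℕ (n ℕ.∸ m)           ≡⟨ cong -_ (fromℕ-∸ m≤n) ⟩
    - (fromℕ n - fromℕ m)       ≡⟨ ⁻¹-anti-homo-// (fromℕ n) (fromℕ m) ⟩
    fromℕ m - fromℕ n           ∎
    where open ≡-Reasoning

  ⟦+⟧ℤ : ∀ i j → ⟦ i ℤ.+ j ⟧ℤ ≡ ⟦ i ⟧ℤ + ⟦ j ⟧ℤ
  ⟦+⟧ℤ (ℤ.+ m)   (ℤ.+ n)   = fromℕ-+ m n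
  ⟦+⟧ℤ (ℤ.+ m)   -[1+ n ]  = ⟦⊖⟧ℤ m (suc n)
  ⟦+⟧ℤ -[1+ m ]  (ℤ.+ n)   = trans (⟦⊖⟧ℤ n (suc m)) (+-comm _ _)
  ⟦+⟧ℤ -[1+ m ]  -[1+ n ]  = begin
    - fromℕ (suc (suc (m ℕ.+ n)))       ≡⟨ cong (λ t → - fromℕ (suc t)) (ℕ.+-suc m n) ⟨
    - fromℕ (suc m ℕ.+ suc n)           ≡⟨ cong -_ (fromℕ-+ (suc m) (suc n)) ⟩
    - (fromℕ (suc m) + fromℕ (suc n))   ≡⟨ ⁻¹-∙-comm _ _ ⟨
    - fromℕ (suc m) + - fromℕ (suc n)   ∎
    where open ≡-Reasoning

  sign : Sign → ℝ
  sign Sign.+ = 1ℝ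
  sign Sign.- = - 1ℝ

  sign-* : ∀ s t → sign (s Sign.* t) ≡ sign s * sign t
  sign-* Sign.+ t       = sym (*-identity _)
  sign-* Sign.- Sign.+  = sym (*-identityʳ _)
  sign-* Sign.- Sign.-  = sym -1*-1≡1

  ⟦◃⟧ℤ : ∀ s n → ⟦ s ℤ.◃ n ⟧ℤ ≡ sign s * fromℕ n
  ⟦◃⟧ℤ s       zero    = sym (zeroʳ (sign s))
  ⟦◃⟧ℤ Sign.+ (suc n) = sym (*-identity _)
  ⟦◃⟧ℤ Sign.- (suc n) = sym (-1*x≈-x _)

  ⟦⟧ℤ-sign-abs : ∀ i → ⟦ i ⟧ℤ ≡ sign (ℤ.sign i) * fromℕ ℤ.∣ i ∣
  ⟦⟧ℤ-sign-abs i = trans (cong ⟦_⟧ℤ (sym (ℤ.◃-inverse i))) (⟦◃⟧ℤ (ℤ.sign i) ℤ.∣ i ∣)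

  ⟦*⟧ℤ : ∀ i j → ⟦ i ℤ.* j ⟧ℤ ≡ ⟦ i ⟧ℤ * ⟦ j ⟧ℤ
  ⟦*⟧ℤ i j = begin
    ⟦ i ℤ.* j ⟧ℤ                                          ≡⟨ ⟦◃⟧ℤ (ℤ.sign i Sign.* ℤ.sign j) (ℤ.∣ i ∣ ℕ.* ℤ.∣ j ∣) ⟩
    sign (ℤ.sign i Sign.* ℤ.sign j) * fromℕ (ℤ.∣ i ∣ ℕ.* ℤ.∣ j ∣)
      ≡⟨ cong₂ _*_ (sign-* (ℤ.sign i) (ℤ.sign j)) (fromℕ-* ℤ.∣ i ∣ ℤ.∣ j ∣) ⟩
    (sign (ℤ.sign i) * sign (ℤ.sign j)) * (fromℕ ℤ.∣ i ∣ * fromℕ ℤ.∣ j ∣)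
      ≡⟨ interchange _ _ _ _ ⟩
    (sign (ℤ.sign i) * fromℕ ℤ.∣ i ∣) * (sign (ℤ.sign j) * fromℕ ℤ.∣ j ∣)
      ≡⟨ cong₂ _*_ (⟦⟧ℤ-sign-abs i) (⟦⟧ℤ-sign-abs j) ⟨
    ⟦ i ⟧ℤ * ⟦ j ⟧ℤ                                       ∎
    where open ≡-Reasoning

  ⟦⟧ℤ-homomorphism : ℤ.+-*-rawRing -Raw-AlmostCommutative⟶ fromCommutativeRing commutativeRing
  ⟦⟧ℤ-homomorphism = record
    { ⟦_⟧ = ⟦_⟧ℤ ; +-homo = ⟦+⟧ℤ ; *-homo = ⟦*⟧ℤ ; -‿homo = ⟦-⟧ℤ
    ; 0-homo = refl ; 1-homo = +-identityʳ 1ℝ }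

  open import Algebra.Solver.Ring ℤ.+-*-rawRing (fromCommutativeRing commutativeRing) ⟦⟧ℤ-homomorphism
    (λ i j → Maybe.map (cong ⟦_⟧ℤ) (dec⇒maybe (i ℤ.≟ j))) public
    using (solve; _:=_; _:+_; _:*_; _:-_)

  <ℝ⇒≢ : ∀ {x y} → x <ℝ y → x ≢ y
  <ℝ⇒≢ {x} x<y refl = <-irrefl x x<y

  0<1 : 0ℝ <ℝ 1ℝ
  0<1 with <-trichotomy 0ℝ 1ℝ
  ... | inj₁ 0<1         = 0<1
  ... | inj₂ (inj₁ 0≡1)  = ⊥-elim (0≢1 0≡1)
  ... | inj₂ (inj₂ 1<0)  = ⊥-elim (<-irrefl 0ℝ (<-trans 0ℝ 1ℝ 0ℝ 0<1′ 1<0))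
    where
    0<-1 : 0ℝ <ℝ - 1ℝ
    0<-1 = subst₂ _<ℝ_ (+-inverse 1ℝ) (+-identity (- 1ℝ)) (+-mono-< 1ℝ 0ℝ (- 1ℝ) 1<0)
    0<1′ : 0ℝ <ℝ 1ℝ
    0<1′ = subst (0ℝ <ℝ_) -1*-1≡1 (*-pos _ _ 0<-1 0<-1)

  0<fromℕ-suc : ∀ n → 0ℝ <ℝ fromℕ (suc n)
  0<fromℕ-suc zero    = subst (0ℝ <ℝ_) (sym (+-identityʳ 1ℝ)) 0<1
  0<fromℕ-suc (suc n) = <-trans _ _ _ (0<fromℕ-suc n)
    (subst (_<ℝ fromℕ (suc (suc n))) (+-identity _) (+-mono-< 0ℝ 1ℝ (fromℕ (suc n)) 0<1))

  fromℕ≢0 : ∀ {n} → 1 ℕ.≤ n → fromℕ n ≢ 0ℝ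
  fromℕ≢0 {suc n} _ = ≢-sym (<ℝ⇒≢ (0<fromℕ-suc n))

  _≟0 : ∀ x → Dec (x ≡ 0ℝ)
  x ≟0 with <-trichotomy x 0ℝ
  ... | inj₁ x<0        = no (<ℝ⇒≢ x<0)
  ... | inj₂ (inj₁ x≡0) = yes x≡0
  ... | inj₂ (inj₂ 0<x) = no (≢-sym (<ℝ⇒≢ 0<x))

  -- With the junk value 0ℝ ⁻¹ = 0ℝ.
  _⁻¹ : ℝ → ℝ
  x ⁻¹ with x ≟0
  ... | yes _   = 0ℝ
  ... | no  x≢0 = proj₁ (*-inverse x x≢0)

  *-inverseʳ : ∀ {x} → x ≢ 0ℝ → x * x ⁻¹ ≡ 1ℝ
  *-inverseʳ {x} x≢0 with x ≟0
  ... | yes x≡0 = ⊥-elim (x≢0 x≡0)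
  ... | no  x≢0′ = proj₂ (*-inverse x x≢0′)

  *-cancelˡ : ∀ {x y z} → x ≢ 0ℝ → x * y ≡ x * z → y ≡ z
  *-cancelˡ {x} {y} {z} x≢0 xy≡xz = begin
    y                  ≡⟨ *-identity y ⟨
    1ℝ * y             ≡⟨ cong (_* y) (*-inverseʳ x≢0) ⟨
    (x * x ⁻¹) * y     ≡⟨ reassociate y ⟩
    x ⁻¹ * (x * y)     ≡⟨ cong (x ⁻¹ *_) xy≡xz ⟩
    x ⁻¹ * (x * z)     ≡⟨ reassociate z ⟨
    (x * x ⁻¹) * z     ≡⟨ cong (_* z) (*-inverseʳ x≢0) ⟩
    1ℝ * z             ≡⟨ *-identity z ⟩
    z                  ∎
    where
    open ≡-Reasoning
    reassociate : ∀ t → (x * x ⁻¹) * t ≡ x ⁻¹ * (x * t)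
    reassociate = solve 3 (λ x x⁻¹ t → (x :* x⁻¹) :* t := x⁻¹ :* (x :* t)) refl x (x ⁻¹)

  x*y≡0⇒x≡0⊎y≡0 : ∀ {x y} → x * y ≡ 0ℝ → x ≡ 0ℝ ⊎ y ≡ 0ℝ
  x*y≡0⇒x≡0⊎y≡0 {x} {y} xy≡0 with x ≟0
  ... | yes x≡0 = inj₁ x≡0
  ... | no  x≢0 = inj₂ (*-cancelˡ x≢0 (trans xy≡0 (sym (zeroʳ x))))

  x*x≡1⇒x≡±1 : ∀ {x} → x * x ≡ 1ℝ → x ≡ 1ℝ ⊎ x ≡ - 1ℝ
  x*x≡1⇒x≡±1 {x} xx≡1 with x*y≡0⇒x≡0⊎y≡0 {x - 1ℝ} {x + 1ℝ} factorised
    where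
    factorised : (x - 1ℝ) * (x + 1ℝ) ≡ 0ℝ
    factorised = trans (solve 2 (λ x u → (x :- u) :* (x :+ u) := x :* x :- u :* u) refl x 1ℝ)
                       (x≈y⇒x∙y⁻¹≈ε (trans xx≡1 (sym (*-identity 1ℝ))))
  ... | inj₁ x-1≡0 = inj₁ (x∙y⁻¹≈ε⇒x≈y x 1ℝ x-1≡0)
  ... | inj₂ x+1≡0 = inj₂ (x∙y⁻¹≈ε⇒x≈y x (- 1ℝ) (trans (cong (x +_) (⁻¹-involutive 1ℝ)) x+1≡0))

  xy+1≡x+y⇒x≡1⊎y≡1 : ∀ {x y} → x * y + 1ℝ ≡ x + y → x ≡ 1ℝ ⊎ y ≡ 1ℝ
  xy+1≡x+y⇒x≡1⊎y≡1 {x} {y} eq with x*y≡0⇒x≡0⊎y≡0 {x - 1ℝ} {y - 1ℝ} factorised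
    where
    factorised : (x - 1ℝ) * (y - 1ℝ) ≡ 0ℝ
    factorised = begin
      (x - 1ℝ) * (y - 1ℝ)                        ≡⟨ solve 3 (λ x y u → (x :- u) :* (y :- u) := (x :* y :+ u :* u) :- (u :* x :+ u :* y)) refl x y 1ℝ ⟩
      (x * y + 1ℝ * 1ℝ) - (1ℝ * x + 1ℝ * y)       ≡⟨ cong₂ (λ s t → (x * y + s) - t) (*-identity 1ℝ) (cong₂ _+_ (*-identity x) (*-identity y)) ⟩
      (x * y + 1ℝ) - (x + y)                      ≡⟨ x≈y⇒x∙y⁻¹≈ε eq ⟩
      0ℝ                                          ∎
      where open ≡-Reasoning
  ... | inj₁ x-1≡0 = inj₁ (x∙y⁻¹≈ε⇒x≈y x 1ℝ x-1≡0)
  ... | inj₂ y-1≡0 = inj₂ (x∙y⁻¹≈ε⇒x≈y y 1ℝ y-1≡0)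

  +*-solveʳ : ∀ {b} x y → b ≢ 0ℝ → x + b * ((y - x) * b ⁻¹) ≡ y
  +*-solveʳ {b} x y b≢0 = begin
    x + b * ((y - x) * b ⁻¹)   ≡⟨ solve 4 (λ x y b b⁻¹ → x :+ b :* ((y :- x) :* b⁻¹) := x :+ (y :- x) :* (b :* b⁻¹)) refl x y b (b ⁻¹) ⟩
    x + (y - x) * (b * b ⁻¹)   ≡⟨ cong (λ t → x + (y - x) * t) (*-inverseʳ b≢0) ⟩
    x + (y - x) * 1ℝ           ≡⟨ cong (x +_) (*-identityʳ (y - x)) ⟩
    x + (y - x)                ≡⟨ solve 2 (λ x y → x :+ (y :- x) := y) refl x y ⟩
    y                          ∎
    where open ≡-Reasoning

  x≢0∧y≢0⇒xy≢0 : ∀ {x y} → x ≢ 0ℝ → y ≢ 0ℝ → x * y ≢ 0ℝ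
  x≢0∧y≢0⇒xy≢0 x≢0 y≢0 xy≡0 = [ x≢0 , y≢0 ]′ (x*y≡0⇒x≡0⊎y≡0 xy≡0)

  square-product-constraint : ∀ {c b s r S R} → c ≢ 0ℝ → c + b ≢ 0ℝ →
    c + b * S ≡ (c + b) * (s * s) →
    c + b * R ≡ (c + b) * (r * r) →
    c + b * (S * R) ≡ (c + b) * ((s * s) * (r * r)) →
    s * s ≡ 1ℝ ⊎ r * r ≡ 1ℝ
  square-product-constraint {c} {b} {s} {r} {S} {R} c≢0 k≢0 eqS eqR eqSR =
    xy+1≡x+y⇒x≡1⊎y≡1 (*-cancelˡ (x≢0∧y≢0⇒xy≢0 c≢0 k≢0) (begin
      (c * k) * (X * Y + 1ℝ)        ≡⟨ distrib (c * k) (X * Y) 1ℝ ⟩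
      (c * k) * (X * Y) + c * k * 1ℝ ≡⟨ cong ((c * k) * (X * Y) +_) (*-identityʳ (c * k)) ⟩
      (c * k) * (X * Y) + c * k      ≡⟨ ∙-cancelʳ (b * (k * (X * Y))) _ _ key ⟩
      (c * k) * (X + Y)              ∎))
    where
    open ≡-Reasoning
    k X Y : ℝ
    k = c + b
    X = s * s
    Y = r * r
    -- The semiring identity (c + bS)(c + bR) + bc + c² = c(c + bS) + c(c + bR) + b(c + bSR),
    -- into which the three hypotheses are substituted.
    key : (c * k) * (X * Y) + c * k + b * (k * (X * Y)) ≡ (c * k) * (X + Y) + b * (k * (X * Y))
    key = begin
      (c * k) * (X * Y) + c * k + b * (k * (X * Y))
        ≡⟨ solve 4 (λ c b X Y → (c :* (c :+ b)) :* (X :* Y) :+ c :* (c :+ b) :+ b :* ((c :+ b) :* (X :* Y))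
                               := ((c :+ b) :* X) :* ((c :+ b) :* Y) :+ b :* c :+ c :* c) refl c b X Y ⟩
      (k * X) * (k * Y) + b * c + c * c
        ≡⟨ cong₂ (λ P Q → P * Q + b * c + c * c) eqS eqR ⟨
      (c + b * S) * (c + b * R) + b * c + c * c
        ≡⟨ solve 4 (λ c b S R → (c :+ b :* S) :* (c :+ b :* R) :+ b :* c :+ c :* c
                             := c :* (c :+ b :* S) :+ c :* (c :+ b :* R) :+ b :* (c :+ b :* (S :* R))) refl c b S R ⟩
      c * (c + b * S) + c * (c + b * R) + b * (c + b * (S * R))
        ≡⟨ cong₂ _+_ (cong₂ (λ P Q → c * P + c * Q) eqS eqR) (cong (b *_) eqSR) ⟩
      c * (k * X) + c * (k * Y) + b * (k * (X * Y))
        ≡⟨ cong (_+ b * (k * (X * Y))) (solve 4 (λ c k X Y → c :* (k :* X) :+ c :* (k :* Y) := (c :* k) :* (X :+ Y)) refl c k X Y) ⟩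
      (c * k) * (X + Y) + b * (k * (X * Y)) ∎

  x*x≡1⇒y*x≡±y : ∀ {x y} → x * x ≡ 1ℝ → y * x ≡ y ⊎ y * x ≡ - y
  x*x≡1⇒y*x≡±y {y = y} xx≡1 with x*x≡1⇒x≡±1 xx≡1
  ... | inj₁ refl = inj₁ (*-identityʳ y)
  ... | inj₂ refl = inj₂ (trans (sym (-‿distribʳ-* y 1ℝ)) (cong -_ (*-identityʳ y)))

module PseudoCosine (RR : RealNumbers) (Γ : DRG) where
  open RealNumbers RR
  open RealArithmetic RR
  open DRG Γ
  open DistanceRegular Γ

  K : ℝ
  K = fromℕ k

  b≢0 : ∀ {i} → i < D → fromℕ (b i) ≢ 0ℝ
  b≢0 i<D = fromℕ≢0 (b-positive i<D)

  nextCosine : ℝ → ℕ → ℝ → ℝ → ℝ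
  nextCosine θ i σᵢ₋₁ σᵢ = (θ * σᵢ - (fromℕ (c i) * σᵢ₋₁ + fromℕ (a i) * σᵢ)) * fromℕ (b i) ⁻¹

  cosinePair : ℝ → ℕ → ℝ × ℝ
  cosinePair θ zero    = 1ℝ , nextCosine θ 0 1ℝ 1ℝ
  cosinePair θ (suc i) = let (σᵢ , σᵢ₊₁) = cosinePair θ i in σᵢ₊₁ , nextCosine θ (suc i) σᵢ σᵢ₊₁

  pseudoCosine : ℝ → ℕ → ℝ
  pseudoCosine θ i = proj₁ (cosinePair θ i)

  pseudoCosine-isPseudoCosine : ∀ θ → IsPseudoCosine RR Γ θ (pseudoCosine θ)
  pseudoCosine-isPseudoCosine θ = refl , λ
    { zero    i<D → +*-solveʳ _ (θ * 1ℝ) (b≢0 i<D)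
    ; (suc i) i<D → +*-solveʳ _ (θ * pseudoCosine θ (suc i)) (b≢0 i<D) }

  pseudoCosine-unique : ∀ {θ σ ρ} → IsPseudoCosine RR Γ θ σ → IsPseudoCosine RR Γ θ ρ →
                        ∀ i → i ≤ D → σ i ≡ ρ i
  pseudoCosine-unique {θ} {σ} {ρ} (σ₀ , σ-rec) (ρ₀ , ρ-rec) i i≤D = proj₁ (agree i i≤D)
    where
    agree : ∀ i → i ≤ D → σ i ≡ ρ i × σ (i ∸ 1) ≡ ρ (i ∸ 1)
    agree zero    _   = trans σ₀ (sym ρ₀) , trans σ₀ (sym ρ₀)
    agree (suc i) i<D with agree i (<⇒≤ i<D)
    ... | σᵢ≡ρᵢ , σᵢ₋₁≡ρᵢ₋₁ = *-cancelˡ (b≢0 i<D) (∙-cancelˡ lower _ _ (begin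
      lower + B * σ (suc i)                     ≡⟨ cong (_+ B * σ (suc i)) (cong₂ _+_ (cong (C *_) σᵢ₋₁≡ρᵢ₋₁) (cong (A *_) σᵢ≡ρᵢ)) ⟨
      C * σ (i ∸ 1) + A * σ i + B * σ (suc i)   ≡⟨ σ-rec i i<D ⟩
      θ * σ i                                   ≡⟨ cong (θ *_) σᵢ≡ρᵢ ⟩
      θ * ρ i                                   ≡⟨ ρ-rec i i<D ⟨
      lower + B * ρ (suc i)                     ∎)) , σᵢ≡ρᵢ
      where
      open ≡-Reasoning
      C A B lower : ℝ
      C = fromℕ (c i)
      A = fromℕ (a i)
      B = fromℕ (b i)
      lower = C * ρ (i ∸ 1) + A * ρ i

  pseudoCosine-cong : ∀ {θ σ ρ} → (∀ i → i ≤ D → σ i ≡ ρ i) → IsPseudoCosine RR Γ θ σ → IsPseudoCosine RR Γ θ ρ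
  pseudoCosine-cong {θ} {σ} {ρ} σ≗ρ (σ₀ , σ-rec) = trans (sym (σ≗ρ 0 z≤n)) σ₀ , λ i i<D →
    let i≤D = <⇒≤ i<D in
    trans (sym (cong₂ _+_ (cong₂ _+_ (cong (fromℕ (c i) *_) (σ≗ρ (i ∸ 1) (≤-trans (m∸n≤m i 1) i≤D)))
                                     (cong (fromℕ (a i) *_) (σ≗ρ i i≤D)))
                          (cong (fromℕ (b i) *_) (σ≗ρ (suc i) i<D))))
          (trans (σ-rec i i<D) (cong (θ *_) (σ≗ρ i i≤D)))

  module _ (a≡0 : ∀ i → i < D → a i ≡ 0) where

    c+b≡K : ∀ i → i < D → fromℕ (c i) + fromℕ (b i) ≡ K
    c+b≡K zero    _   = +-identity K
    c+b≡K (suc i) i<D = begin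
      C + B                                  ≡⟨ cong (_+ B) (+-identityʳ C) ⟨
      C + 0ℝ + B                             ≡⟨ cong (λ t → C + fromℕ t + B) (a≡0 (suc i) i<D) ⟨
      C + A + B
        ≡⟨ trans (fromℕ-+ (c (suc i) ℕ.+ a (suc i)) (b (suc i))) (cong (_+ B) (fromℕ-+ (c (suc i)) (a (suc i)))) ⟨
      fromℕ (c (suc i) ℕ.+ a (suc i) ℕ.+ b (suc i))
        ≡⟨ cong fromℕ (c+a+b≡k i<D) ⟩
      K ∎
      where
      open ≡-Reasoning
      C A B : ℝ
      C = fromℕ (c (suc i))
      A = fromℕ (a (suc i))
      B = fromℕ (b (suc i))

    Recurrence : ℝ → (ℕ → ℝ) → Set
    Recurrence θ σ = ∀ i → i < D → fromℕ (c i) * σ (i ∸ 1) + fromℕ (b i) * σ (suc i) ≡ θ * σ i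

    drop-a : ∀ {i} → i < D → ∀ x y z → fromℕ (c i) * x + fromℕ (a i) * y + z ≡ fromℕ (c i) * x + z
    drop-a {i} i<D x y z = cong (_+ z) (begin
      fromℕ (c i) * x + fromℕ (a i) * y   ≡⟨ cong (λ t → fromℕ (c i) * x + fromℕ t * y) (a≡0 i i<D) ⟩
      fromℕ (c i) * x + 0ℝ * y            ≡⟨ cong (fromℕ (c i) * x +_) (zeroˡ y) ⟩
      fromℕ (c i) * x + 0ℝ                ≡⟨ +-identityʳ _ ⟩
      fromℕ (c i) * x                     ∎)
      where open ≡-Reasoning

    isPseudoCosine⇒recurrence : ∀ {θ σ} → IsPseudoCosine RR Γ θ σ → Recurrence θ σ
    isPseudoCosine⇒recurrence (_ , σ-rec) i i<D = trans (sym (drop-a i<D _ _ _)) (σ-rec i i<D)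

    recurrence⇒isPseudoCosine : ∀ {θ σ} → σ 0 ≡ 1ℝ → Recurrence θ σ → IsPseudoCosine RR Γ θ σ
    recurrence⇒isPseudoCosine σ₀ rec = σ₀ , λ i i<D → trans (drop-a i<D _ _ _) (rec i i<D)

    constant-isPseudoCosine : IsPseudoCosine RR Γ K (λ _ → 1ℝ)
    constant-isPseudoCosine = recurrence⇒isPseudoCosine refl λ i i<D →
      trans (sym (distribʳ 1ℝ (fromℕ (c i)) (fromℕ (b i)))) (cong (_* 1ℝ) (c+b≡K i i<D))

    open RawSemiringDefinitions (Semiring.rawSemiring semiring) using (_^_)

    twist-isPseudoCosine : ∀ {ε θ σ} → ε * ε ≡ 1ℝ → IsPseudoCosine RR Γ θ σ →
                           IsPseudoCosine RR Γ (ε * θ) (λ i → σ i * ε ^ i)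
    twist-isPseudoCosine {ε} {θ} {σ} εε≡1 hσ =
      recurrence⇒isPseudoCosine (trans (*-identityʳ (σ 0)) (proj₁ hσ)) λ i i<D → begin
        C i * (σ (i ∸ 1) * ε ^ (i ∸ 1)) + B i * (σ (suc i) * ε ^ suc i)
          ≡⟨ cong (_+ B i * (σ (suc i) * ε ^ suc i)) (shift i) ⟩
        C i * (σ (i ∸ 1) * ε ^ suc i) + B i * (σ (suc i) * ε ^ suc i)
          ≡⟨ solve 5 (λ C B x y e → C :* (x :* e) :+ B :* (y :* e) := (C :* x :+ B :* y) :* e) refl
                     (C i) (B i) (σ (i ∸ 1)) (σ (suc i)) (ε ^ suc i) ⟩
        (C i * σ (i ∸ 1) + B i * σ (suc i)) * ε ^ suc i
          ≡⟨ cong (_* ε ^ suc i) (isPseudoCosine⇒recurrence hσ i i<D) ⟩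
        (θ * σ i) * (ε * ε ^ i)
          ≡⟨ solve 4 (λ θ x ε q → (θ :* x) :* (ε :* q) := (ε :* θ) :* (x :* q)) refl θ (σ i) ε (ε ^ i) ⟩
        (ε * θ) * (σ i * ε ^ i) ∎
      where
      open ≡-Reasoning
      C B : ℕ → ℝ
      C i = fromℕ (c i)
      B i = fromℕ (b i)
      -- c₀ = 0 kills the term at i = 0; otherwise ε² = 1.
      shift : ∀ i → C i * (σ (i ∸ 1) * ε ^ (i ∸ 1)) ≡ C i * (σ (i ∸ 1) * ε ^ suc i)
      shift zero    = trans (zeroˡ _) (sym (zeroˡ _))
      shift (suc i) = cong (λ t → C (suc i) * (σ i * t)) (sym (begin
        ε * (ε * ε ^ i) ≡⟨ *-assoc ε ε (ε ^ i) ⟨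
        (ε * ε) * ε ^ i ≡⟨ cong (_* ε ^ i) εε≡1 ⟩
        1ℝ * ε ^ i      ≡⟨ *-identity (ε ^ i) ⟩
        ε ^ i           ∎))

    tightPair-with-±K : ∀ {ε} → ε * ε ≡ 1ℝ → ∀ θ → TightPair RR Γ θ (ε * K)
    tightPair-with-±K {ε} εε≡1 θ σ ρ hσ hρ =
      ε * θ , pseudoCosine-cong (λ i i≤D → cong (σ i *_) (ρ≡ε^ i i≤D)) (twist-isPseudoCosine εε≡1 hσ)
      where
      ρ≡ε^ : ∀ i → i ≤ D → ε ^ i ≡ ρ i
      ρ≡ε^ i i≤D = trans (sym (*-identity (ε ^ i)))
        (pseudoCosine-unique (twist-isPseudoCosine εε≡1 constant-isPseudoCosine) hρ i i≤D)

    pseudoCosine-σ₁-σ₂ : ∀ {θ σ} → 1 < D → IsPseudoCosine RR Γ θ σ →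
      K * σ 1 ≡ θ × fromℕ (c 1) + fromℕ (b 1) * σ 2 ≡ (fromℕ (c 1) + fromℕ (b 1)) * (σ 1 * σ 1)
    pseudoCosine-σ₁-σ₂ {θ} {σ} 1<D hσ@(σ₀ , _) = Kσ₁≡θ , (begin
      C + B * σ 2               ≡⟨ cong (_+ B * σ 2) (trans (cong (C *_) σ₀) (*-identityʳ C)) ⟨
      C * σ 0 + B * σ 2         ≡⟨ isPseudoCosine⇒recurrence hσ 1 1<D ⟩
      θ * σ 1                   ≡⟨ cong (_* σ 1) Kσ₁≡θ ⟨
      (K * σ 1) * σ 1           ≡⟨ *-assoc K (σ 1) (σ 1) ⟩
      K * (σ 1 * σ 1)           ≡⟨ cong (_* (σ 1 * σ 1)) (c+b≡K 1 1<D) ⟨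
      (C + B) * (σ 1 * σ 1)     ∎)
      where
      open ≡-Reasoning
      C B : ℝ
      C = fromℕ (c 1)
      B = fromℕ (b 1)
      Kσ₁≡θ : K * σ 1 ≡ θ
      Kσ₁≡θ = begin
        K * σ 1                 ≡⟨ +-identity (K * σ 1) ⟨
        0ℝ + K * σ 1            ≡⟨ cong (_+ K * σ 1) (zeroˡ (σ 0)) ⟨
        0ℝ * σ 0 + K * σ 1      ≡⟨ isPseudoCosine⇒recurrence hσ 0 (<⇒≤ 1<D) ⟩
        θ * σ 0                 ≡⟨ cong (θ *_) σ₀ ⟩
        θ * 1ℝ                  ≡⟨ *-identityʳ θ ⟩
        θ                       ∎

    tightPair⇒±K : 1 < D → ∀ {θ θ′} → TightPair RR Γ θ θ′ → (θ ≡ K ⊎ θ ≡ - K) ⊎ (θ′ ≡ K ⊎ θ′ ≡ - K)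
    tightPair⇒±K 1<D {θ} {θ′} tight =
      Sum.map (±K (proj₁ σ-terms)) (±K (proj₁ ρ-terms))
        (square-product-constraint C≢0 C+B≢0 (proj₂ σ-terms) (proj₂ ρ-terms) τ-eq)
      where
      C B : ℝ
      C = fromℕ (c 1)
      B = fromℕ (b 1)
      C≢0 : C ≢ 0ℝ
      C≢0 = fromℕ≢0 (c₁-positive (<⇒≤ 1<D))
      C+B≢0 : C + B ≢ 0ℝ
      C+B≢0 = subst (_≢ 0ℝ) (sym (c+b≡K 1 1<D)) (b≢0 (<⇒≤ 1<D))
      σ ρ : ℕ → ℝ
      σ = pseudoCosine θ
      ρ = pseudoCosine θ′
      hσ : IsPseudoCosine RR Γ θ σ
      hσ = pseudoCosine-isPseudoCosine θ
      hρ : IsPseudoCosine RR Γ θ′ ρ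
      hρ = pseudoCosine-isPseudoCosine θ′
      σ-terms : K * σ 1 ≡ θ × C + B * σ 2 ≡ (C + B) * (σ 1 * σ 1)
      σ-terms = pseudoCosine-σ₁-σ₂ 1<D hσ
      ρ-terms : K * ρ 1 ≡ θ′ × C + B * ρ 2 ≡ (C + B) * (ρ 1 * ρ 1)
      ρ-terms = pseudoCosine-σ₁-σ₂ 1<D hρ
      τ-eq : C + B * (σ 2 * ρ 2) ≡ (C + B) * ((σ 1 * σ 1) * (ρ 1 * ρ 1))
      τ-eq = trans (proj₂ (pseudoCosine-σ₁-σ₂ 1<D (proj₂ (tight σ ρ hσ hρ))))
        (cong ((C + B) *_) (solve 2 (λ s r → (s :* r) :* (s :* r) := (s :* s) :* (r :* r)) refl (σ 1) (ρ 1)))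
      ±K : ∀ {x ϑ} → K * x ≡ ϑ → x * x ≡ 1ℝ → ϑ ≡ K ⊎ ϑ ≡ - K
      ±K Kx≡ϑ xx≡1 = Sum.map (trans (sym Kx≡ϑ)) (trans (sym Kx≡ϑ)) (x*x≡1⇒y*x≡±y xx≡1)

theorem5p3 : (RR : RealNumbers) (Γ : DRG) → 3 ≤ DRG.D Γ →
    DRG.Bipartite Γ ⊎ DRG.AlmostBipartite Γ →
    ((θ : RealNumbers.ℝ RR) → TightPair RR Γ θ (RealNumbers.fromℕ RR (DRG.k Γ)))
    × ((θ : RealNumbers.ℝ RR) → TightPair RR Γ θ (RealNumbers.-_ RR (RealNumbers.fromℕ RR (DRG.k Γ))))
    × ((θ θ' : RealNumbers.ℝ RR) → TightPair RR Γ θ θ' →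
        (θ ≡ RealNumbers.fromℕ RR (DRG.k Γ) ⊎ θ ≡ RealNumbers.-_ RR (RealNumbers.fromℕ RR (DRG.k Γ)))
        ⊎ (θ' ≡ RealNumbers.fromℕ RR (DRG.k Γ) ⊎ θ' ≡ RealNumbers.-_ RR (RealNumbers.fromℕ RR (DRG.k Γ))))
theorem5p3 RR Γ 3≤D bipartite⊎almostBipartite =
    (λ θ → subst (TightPair RR Γ θ) (*-identity K) (tightPair-with-±K a≡0 (*-identity 1ℝ) θ))
  , (λ θ → subst (TightPair RR Γ θ) (-1*x≈-x K) (tightPair-with-±K a≡0 -1*-1≡1 θ))
  , (λ θ θ′ → tightPair⇒±K a≡0 (≤-trans (s≤s (s≤s z≤n)) 3≤D))
  where
  open RealNumbers RR
  open RealArithmetic RR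
  open PseudoCosine RR Γ
  a≡0 : ∀ i → i < DRG.D Γ → DRG.a Γ i ≡ 0
  a≡0 = [ (λ bipartite i i<D → bipartite i (<⇒≤ i<D)) , proj₂ ]′ bipartite⊎almostBipartite
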